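{- For every finite twin-free graph $G$, $\chi_{rlid}(G)\leq \gamma_{id}(G)+1$.
   Context: For a vertex $x$, $N[x]$ is its closed neighborhood; $G$ is twin-free if no two distinct vertices $u,v$ satisfy $N[u]=N[v]$. An identifying code of $G$ is a set $C\subseteq V(G)$ such that $N[v]\cap C\neq\emptyset$ for every vertex $v$ and $N[u]\cap C\neq N[v]\cap C$ for every pair of distinct vertices $u,v$; $\gamma_{id}(G)$ is the minimum size of an identifying code. An $rlid$-coloring of $G$ is a map $c:V(G)\to\mathbb{N}$ (not necessarily proper) such that for every pair of adjacent vertices $u,v$ with $N[u]\neq N[v]$ we have $c(N[u])\neq c(N[v])$, where $c(X)=\{c(x):x\in X\}$; $\chi_{rlid}(G)$ is the minimum number of colors in an $rlid$-coloring of $G$. -}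

module Defs where

open import Data.Nat using (ℕ; suc)
open import Data.Fin using (Fin)
open import Data.Bool using (Bool; true; false)
open import Data.Product using (Σ; ∃; ∃-syntax; _×_; _,_)
open import Data.Sum using (_⊎_)
open import Relation.Nullary using (¬_)
open import Relation.Binary.PropositionalEquality using (_≡_)
open import Function.Bundles using (_⇔_)
open import Data.Fin.Subset using (Subset; _∈_; ∣_∣)

record Graph (n : ℕ) : Set where
  field
    adj       : Fin n → Fin n → Bool
    irrefl    : ∀ x → adj x x ≡ false
    symmetric : ∀ x y → adj x y ≡ adj y x

module _ {n : ℕ} (G : Graph n) where
  open Graph G

  Adjacent : Fin n → Fin n → Set
  Adjacent x y = adj x y ≡ true

  InN : Fin n → Fin n → Set
  InN x y = (x ≡ y) ⊎ Adjacent x y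

  SameN : Fin n → Fin n → Set
  SameN u v = ∀ y → InN u y ⇔ InN v y

  TwinFree : Set
  TwinFree = ∀ u v → SameN u v → u ≡ v

  InNC : Subset n → Fin n → Fin n → Set
  InNC C v y = InN v y × (y ∈ C)

  IdentifyingCode : Subset n → Set
  IdentifyingCode C =
    (∀ v → ∃[ y ] InNC C v y) ×
    (∀ u v → ¬ (u ≡ v) → ¬ (∀ y → InNC C u y ⇔ InNC C v y))

  ColorIn : {k : ℕ} → (Fin n → Fin k) → Fin n → Fin k → Set
  ColorIn c x col = ∃[ y ] (InN x y × (c y ≡ col))

  IsRlidColoring : {k : ℕ} → (Fin n → Fin k) → Set
  IsRlidColoring {k} c =
    ∀ u v → Adjacent u v → ¬ SameN u v →
      ¬ (∀ col → ColorIn c u col ⇔ ColorIn c v col)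

  RlidColorable : ℕ → Set
  RlidColorable k = Σ (Fin n → Fin k) IsRlidColoring

-- Number the vertices of the identifying code C as 1, …, |C| and colour every
-- vertex outside C with 0. A colour ≥ 1 then names a single code vertex, so
-- c(N[u]) determines N[u] ∩ C. Adjacent u, v with N[u] ≠ N[v] are distinct,
-- hence separated by C, hence receive different colour sets.
module Submission where

open import Defs
open import Data.Nat using (ℕ; suc)
open import Data.Fin using (Fin; zero; suc; punchIn)
open import Data.Fin.Properties using (punchIn-injective; punchInᵢ≢i)
open import Data.Fin.Subset using (Subset; ∣_∣; _∈_; inside; outside)
open import Data.Vec.Base using (_∷_; here; there)
open import Data.Product using (_,_)
open import Data.Empty using (⊥-elim)
open import Function.Bundles using (mk⇔; Equivalence)
open import Relation.Binary.PropositionalEquality using (_≡_; _≢_; refl; sym; cong; subst)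

-- rank p x is the position (starting at 1) of x among the members of p, and 0 if x ∉ p.
rank : ∀ {n} (p : Subset n) → Fin n → Fin (suc ∣ p ∣)
rank (inside  ∷ p) zero    = suc zero
rank (inside  ∷ p) (suc x) = punchIn (suc zero) (rank p x)
rank (outside ∷ p) zero    = zero
rank (outside ∷ p) (suc x) = rank p x

punchIn-suc≡zero⇒≡zero : ∀ {m} (i : Fin (suc m)) (j : Fin (suc m)) →
                         punchIn (suc i) j ≡ zero → j ≡ zero
punchIn-suc≡zero⇒≡zero i zero _ = refl

rank-member≢zero : ∀ {n} (p : Subset n) {x : Fin n} → x ∈ p → rank p x ≢ zero
rank-member≢zero (inside  ∷ p) here      ()
rank-member≢zero (inside  ∷ p) (there x∈p) eq =
  rank-member≢zero p x∈p (punchIn-suc≡zero⇒≡zero zero _ eq)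
rank-member≢zero (outside ∷ p) (there x∈p) eq = rank-member≢zero p x∈p eq

rank-injectiveˡ : ∀ {n} (p : Subset n) {x y : Fin n} → x ∈ p →
                  rank p x ≡ rank p y → x ≡ y
rank-injectiveˡ (inside ∷ p) {zero}  {zero}  _ _ = refl
rank-injectiveˡ (inside ∷ p) {zero}  {suc y} _ eq =
  ⊥-elim (punchInᵢ≢i (suc zero) (rank p y) (sym eq))
rank-injectiveˡ (inside ∷ p) {suc x} {zero}  _ eq =
  ⊥-elim (punchInᵢ≢i (suc zero) (rank p x) eq)
rank-injectiveˡ (inside ∷ p) {suc x} {suc y} (there x∈p) eq =
  cong suc (rank-injectiveˡ p x∈p (punchIn-injective (suc zero) _ _ eq))
rank-injectiveˡ (outside ∷ p) {suc x} {zero}  (there x∈p) eq =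
  ⊥-elim (rank-member≢zero p x∈p eq)
rank-injectiveˡ (outside ∷ p) {suc x} {suc y} (there x∈p) eq =
  cong suc (rank-injectiveˡ p x∈p eq)

module _ {n : ℕ} (G : Graph n) where

  ColorsIncluded : {k : ℕ} → (Fin n → Fin k) → Fin n → Fin n → Set
  ColorsIncluded c u v = ∀ col → ColorIn G c u col → ColorIn G c v col

  codeNeighbourhood-⊆ : ∀ {k} {C : Subset n} {c : Fin n → Fin k} →
    (∀ {y z} → y ∈ C → c y ≡ c z → y ≡ z) →
    ∀ {u v} → ColorsIncluded c u v → ∀ y → InNC G C u y → InNC G C v y
  codeNeighbourhood-⊆ {c = c} injective u⊆v y (y∈N[u] , y∈C)
    with u⊆v (c y) (y , y∈N[u] , refl)
  ... | z , z∈N[v] , cz≡cy =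
    subst (InN G _) (sym (injective y∈C (sym cz≡cy))) z∈N[v] , y∈C

  sameN-refl : ∀ u → SameN G u u
  sameN-refl u y = mk⇔ (λ t → t) (λ t → t)

  identifyingCode⇒rlidColoring : ∀ {k} {C : Subset n} {c : Fin n → Fin k} →
    IdentifyingCode G C → (∀ {y z} → y ∈ C → c y ≡ c z → y ≡ z) →
    IsRlidColoring G c
  identifyingCode⇒rlidColoring (_ , separates) injective u v _ N[u]≢N[v] sameColors =
    separates u v u≢v λ y →
      mk⇔ (codeNeighbourhood-⊆ injective (λ col → Equivalence.to (sameColors col)) y)
          (codeNeighbourhood-⊆ injective (λ col → Equivalence.from (sameColors col)) y)
    where
    u≢v : u ≢ v
    u≢v refl = N[u]≢N[v] (sameN-refl u)

mainTheorem7 : (n : ℕ) (G : Graph n) → TwinFree G →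
    (C : Subset n) → IdentifyingCode G C →
    RlidColorable G (suc ∣ C ∣)
mainTheorem7 n G _ C code =
  rank C , identifyingCode⇒rlidColoring G code (rank-injectiveˡ C)
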